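{- Let $x,y$ be integers with $1\leq y\leq x$, and let $I\subseteq[1,x]$ be a set of integers; put $\rho=|I|/x$. Then there exists a set $J\subseteq[1,x]$ of $y$ consecutive integers such that \[ \frac{|I\cap J|}{|J|}\leq\kappa\rho, \] where $\kappa=\kappa(x,y,\rho)\leq 2$ is given by \[ \kappa(x,y,\rho)=\begin{cases}\frac{2}{\rho+1} & \text{if } 1<x/y<2,\\[2pt] \frac{2u}{(u-1)\rho+(u+1)} & \text{if } u-1<x/y<u \text{ for an integer } u\geq3,\\[2pt] 1 & \text{if } y\mid x.\end{cases} \] -}

module Defs where

open import Data.Nat using (ℕ; suc; _+_; _*_; _∸_; _≤ᵇ_; _<ᵇ_; NonZero)
open import Data.Nat.DivMod using (_/_)
open import Data.Nat.Divisibility using (_∣?_)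
open import Data.Bool using (_∧_)
open import Data.Fin using (toℕ)
open import Data.Fin.Subset using (Subset)
open import Data.Vec using (tabulate)
open import Data.Product using (_×_; _,_)
open import Relation.Nullary using (yes; no)

-- Convention: a subset I ⊆ [1,x] of integers is a 'Subset x'; the element
-- i : Fin x represents the integer toℕ i + 1.

-- The block J = [a+1, a+y] of y consecutive integers, as a Subset x
-- (it lies inside [1,x] exactly when a + y ≤ x).
block : (x a y : ℕ) → Subset x
block x a y = tabulate (λ i → (a ≤ᵇ toℕ i) ∧ (toℕ i <ᵇ a + y))

-- κ(x,y,ρ) with ρ = k / x (k = |I|), returned as a fraction (numerator , denominator):
--   y ∣ x                      : κ = 1
--   1 < x/y < 2                : κ = 2/(ρ+1)               = 2x / (k + x)
--   u-1 < x/y < u, u ≥ 3       : κ = 2u/((u-1)ρ + (u+1))   = 2ux / ((u-1)k + (u+1)x)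
-- When y ∤ x, u = ⌊x/y⌋ + 1.
κ : (x y k : ℕ) → .{{NonZero y}} → ℕ × ℕ
κ x y k with y ∣? x
... | yes _ = (1 , 1)
... | no _ with x / y
...   | 1 = (2 * x , k + x)
...   | q = let u = suc q in (2 * u * x , (u ∸ 1) * k + (u + 1) * x)

-- Write x = q y + r with r < y and put t = y − r. Among the q aligned blocks [j y, (j + 1) y)
-- and the final block [x − y, x), let J be one meeting I in the fewest points, m say. The
-- aligned blocks are disjoint, so q m ≤ |I|. The final block consists of t points of [0, q y)
-- and the r points that the aligned blocks miss, so adding it gives (q + 1) m ≤ |I| + t.
-- With k = |I|, the κ-inequality follows from whichever bound is stronger, by the identity
-- (b + c) k (x + t) − (k + t) (b k + c x) = (x − k) (b k − c t),
-- where (b, c) = (1, 1) if q = 1 and (b, c) = (q, q + 2) if q ≥ 2.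
module Submission where

open import Defs
open import Data.Nat using (ℕ; zero; suc; _+_; _*_; _∸_; _≤_; _<_; _≤ᵇ_; _<ᵇ_; z≤n; s≤s; NonZero)
open import Data.Nat.Properties
open import Data.Nat.DivMod using (_/_; _%_; m≡m%n+[m/n]*n; m%n<n; m/n*n≡m; m≥n⇒m/n>0)
open import Data.Nat.Divisibility using (_∣?_)
open import Data.Nat.Tactic.RingSolver using (solve-∀)
open import Data.Bool using (true; false; _∧_)
open import Data.Bool.Properties using (∧-zeroʳ)
open import Data.Fin using (toℕ)
open import Data.Fin.Subset using (Subset; _∩_; ∣_∣)
open import Data.Fin.Subset.Properties using (∣p∣≤n)
open import Data.Vec using ([]; _∷_; tabulate)
open import Data.Vec.Properties using (tabulate-cong)
open import Data.List using (List; applyDownFrom)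
open import Data.List.Relation.Unary.All using (All; _∷_)
open import Data.List.Relation.Unary.All.Properties using (applyDownFrom⁺₁)
open import Data.List.Extrema.Nat using (argmin; argmin-all; f[argmin]≤f[⊤]; f[argmin]≤f[xs])
open import Data.Product using (∃-syntax; _×_; _,_; proj₁; proj₂)
open import Data.Sum using (inj₁; inj₂)
open import Data.Empty using (⊥-elim)
open import Relation.Nullary using (yes; no)
open import Relation.Binary.PropositionalEquality

count : ∀ {n} → Subset n → ℕ → ℕ → ℕ
count []          _       _       = 0
count (_ ∷ I)     (suc a) l       = count I a l
count (_ ∷ _)     zero    zero    = 0
count (true ∷ I)  zero    (suc l) = suc (count I zero l)
count (false ∷ I) zero    (suc l) = count I zero l

count-zero : ∀ {n} (I : Subset n) a → count I a 0 ≡ 0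
count-zero []      a       = refl
count-zero (_ ∷ I) (suc a) = count-zero I a
count-zero (_ ∷ I) zero    = refl

count-≤ : ∀ {n} (I : Subset n) a l → count I a l ≤ l
count-≤ []          a       l       = z≤n
count-≤ (_ ∷ I)     (suc a) l       = count-≤ I a l
count-≤ (_ ∷ I)     zero    zero    = z≤n
count-≤ (true ∷ I)  zero    (suc l) = s≤s (count-≤ I zero l)
count-≤ (false ∷ I) zero    (suc l) = m≤n⇒m≤1+n (count-≤ I zero l)

count-+ : ∀ {n} (I : Subset n) a l₁ l₂ → count I a (l₁ + l₂) ≡ count I a l₁ + count I (a + l₁) l₂
count-+ []          a       l₁       l₂ = refl
count-+ (_ ∷ I)     (suc a) l₁       l₂ = count-+ I a l₁ l₂
count-+ (_ ∷ I)     zero    zero     l₂ = refl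
count-+ (true ∷ I)  zero    (suc l₁) l₂ = cong suc (count-+ I zero l₁ l₂)
count-+ (false ∷ I) zero    (suc l₁) l₂ = count-+ I zero l₁ l₂

∣p∣≡count : ∀ {n} (I : Subset n) → ∣ I ∣ ≡ count I 0 n
∣p∣≡count []          = refl
∣p∣≡count (true ∷ I)  = cong suc (∣p∣≡count I)
∣p∣≡count (false ∷ I) = ∣p∣≡count I

<ᵇ-suc : ∀ a j → (a <ᵇ suc j) ≡ (a ≤ᵇ j)
<ᵇ-suc zero    j = refl
<ᵇ-suc (suc a) j = refl

∣p∩block∣≡count : ∀ {n} (I : Subset n) a l → ∣ I ∩ block n a l ∣ ≡ count I a l
∣p∩block∣≡count []          a       l       = refl
∣p∩block∣≡count (b ∷ I)     (suc a) l       rewrite ∧-zeroʳ b =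
  trans (cong (λ J → ∣ I ∩ J ∣) (tabulate-cong (λ i → cong (_∧ (toℕ i <ᵇ a + l)) (<ᵇ-suc a (toℕ i)))))
        (∣p∩block∣≡count I a l)
∣p∩block∣≡count (b ∷ I)     zero    zero    rewrite ∧-zeroʳ b =
  trans (∣p∩block∣≡count I 0 0) (count-zero I 0)
∣p∩block∣≡count (true ∷ I)  zero    (suc l) = cong suc (∣p∩block∣≡count I 0 l)
∣p∩block∣≡count (false ∷ I) zero    (suc l) = ∣p∩block∣≡count I 0 l

module _ {x} (I : Subset x) (y : ℕ) where

  aligned-blocks-bound : ∀ q {m} → All (λ a → m ≤ count I a y) (applyDownFrom (_* y) q) →
                   q * m ≤ count I 0 (q * y)
  aligned-blocks-bound zero    _          = z≤n
  aligned-blocks-bound (suc q) {m} (m≤ ∷ ms) = begin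
    m + q * m                             ≡⟨ +-comm m (q * m) ⟩
    q * m + m                             ≤⟨ +-mono-≤ (aligned-blocks-bound q ms) m≤ ⟩
    count I 0 (q * y) + count I (q * y) y ≡⟨ count-+ I 0 (q * y) y ⟨
    count I 0 (q * y + y)                 ≡⟨ cong (count I 0) (+-comm (q * y) y) ⟩
    count I 0 (suc q * y)                 ∎
    where open ≤-Reasoning

  -- s is the start of the final block, which meets the aligned blocks in its first t positions.
  sparse-window : ∀ q s r t → y ≡ t + r → s + t ≡ q * y → x ≡ s + y →
    ∃[ a ] (a + y ≤ x × q * ∣ I ∩ block x a y ∣ ≤ ∣ I ∣ × suc q * ∣ I ∩ block x a y ∣ ≤ ∣ I ∣ + t)
  sparse-window q s r t y≡t+r s+t≡qy x≡s+y = a , a+y≤x , aligned-bound , last-bound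
    where
    open ≤-Reasoning
    starts : List ℕ
    starts = applyDownFrom (_* y) q
    a : ℕ
    a = argmin (λ b → count I b y) s starts
    m : ℕ
    m = count I a y

    x≡qy+r : x ≡ q * y + r
    x≡qy+r = begin-equality
      x             ≡⟨ x≡s+y ⟩
      s + y         ≡⟨ cong (s +_) y≡t+r ⟩
      s + (t + r)   ≡⟨ +-assoc s t r ⟨
      s + t + r     ≡⟨ cong (_+ r) s+t≡qy ⟩
      q * y + r     ∎

    ∣I∣≡ : ∣ I ∣ ≡ count I 0 (q * y) + count I (q * y) r
    ∣I∣≡ = trans (∣p∣≡count I) (trans (cong (count I 0) x≡qy+r) (count-+ I 0 (q * y) r))

    aligned-fits : ∀ {j} → j < q → j * y + y ≤ x
    aligned-fits {j} j<q = begin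
      j * y + y  ≡⟨ +-comm (j * y) y ⟩
      suc j * y  ≤⟨ *-monoˡ-≤ y j<q ⟩
      q * y      ≤⟨ m≤m+n (q * y) r ⟩
      q * y + r  ≡⟨ x≡qy+r ⟨
      x          ∎

    a+y≤x : a + y ≤ x
    a+y≤x = argmin-all (λ b → count I b y) {P = λ b → b + y ≤ x}
      (≤-reflexive (sym x≡s+y)) (applyDownFrom⁺₁ (_* y) q aligned-fits)

    qm≤ : q * m ≤ count I 0 (q * y)
    qm≤ = aligned-blocks-bound q (f[argmin]≤f[xs] {f = λ b → count I b y} s starts)

    m≤ : m ≤ t + count I (q * y) r
    m≤ = begin
      m                                 ≤⟨ f[argmin]≤f[⊤] {f = λ b → count I b y} s starts ⟩
      count I s y                       ≡⟨ cong (count I s) y≡t+r ⟩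
      count I s (t + r)                 ≡⟨ count-+ I s t r ⟩
      count I s t + count I (s + t) r   ≡⟨ cong (λ b → count I s t + count I b r) s+t≡qy ⟩
      count I s t + count I (q * y) r   ≤⟨ +-monoˡ-≤ (count I (q * y) r) (count-≤ I s t) ⟩
      t + count I (q * y) r             ∎

    aligned-bound : q * ∣ I ∩ block x a y ∣ ≤ ∣ I ∣
    aligned-bound = begin
      q * ∣ I ∩ block x a y ∣                     ≡⟨ cong (q *_) (∣p∩block∣≡count I a y) ⟩
      q * m                                      ≤⟨ qm≤ ⟩
      count I 0 (q * y)                          ≤⟨ m≤m+n _ _ ⟩
      count I 0 (q * y) + count I (q * y) r      ≡⟨ ∣I∣≡ ⟨
      ∣ I ∣                                      ∎

    last-bound : suc q * ∣ I ∩ block x a y ∣ ≤ ∣ I ∣ + t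
    last-bound = begin
      suc q * ∣ I ∩ block x a y ∣                     ≡⟨ cong (suc q *_) (∣p∩block∣≡count I a y) ⟩
      m + q * m                                      ≤⟨ +-mono-≤ m≤ qm≤ ⟩
      t + count I (q * y) r + count I 0 (q * y)      ≡⟨ rearrange t _ _ ⟩
      count I 0 (q * y) + count I (q * y) r + t      ≡⟨ cong (_+ t) ∣I∣≡ ⟨
      ∣ I ∣ + t                                      ∎
      where
      rearrange : ∀ a b c → a + b + c ≡ c + b + a
      rearrange = solve-∀

m+[n∸m%n]≡[1+m/n]*n : ∀ m n .{{_ : NonZero n}} → m + (n ∸ m % n) ≡ suc (m / n) * n
m+[n∸m%n]≡[1+m/n]*n m n = begin
  m + (n ∸ m % n)                   ≡⟨ cong (_+ (n ∸ m % n)) (m≡m%n+[m/n]*n m n) ⟩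
  m % n + m / n * n + (n ∸ m % n)   ≡⟨ cong (_+ (n ∸ m % n)) (+-comm (m % n) (m / n * n)) ⟩
  m / n * n + m % n + (n ∸ m % n)   ≡⟨ +-assoc (m / n * n) (m % n) (n ∸ m % n) ⟩
  m / n * n + (m % n + (n ∸ m % n)) ≡⟨ cong (m / n * n +_) (m+[n∸m]≡n (<⇒≤ (m%n<n m n))) ⟩
  m / n * n + n                     ≡⟨ +-comm (m / n * n) n ⟩
  suc (m / n) * n                   ∎
  where open ≡-Reasoning

sparse-block : ∀ x y .{{_ : NonZero y}} → y ≤ x → (I : Subset x) →
  ∃[ a ] (a + y ≤ x × x / y * ∣ I ∩ block x a y ∣ ≤ ∣ I ∣ ×
          suc (x / y) * ∣ I ∩ block x a y ∣ ≤ ∣ I ∣ + (y ∸ x % y))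
sparse-block x y y≤x I =
  sparse-window I y (x / y) (x ∸ y) (x % y) (y ∸ x % y) y≡t+r s+t≡qy (sym (m∸n+n≡m y≤x))
  where
  open ≡-Reasoning
  y≡t+r : y ≡ y ∸ x % y + x % y
  y≡t+r = sym (m∸n+n≡m (<⇒≤ (m%n<n x y)))
  s+t≡qy : x ∸ y + (y ∸ x % y) ≡ x / y * y
  s+t≡qy = +-cancelʳ-≡ y _ _ (begin
    x ∸ y + (y ∸ x % y) + y   ≡⟨ +-assoc (x ∸ y) _ y ⟩
    x ∸ y + ((y ∸ x % y) + y) ≡⟨ cong (x ∸ y +_) (+-comm (y ∸ x % y) y) ⟩
    x ∸ y + (y + (y ∸ x % y)) ≡⟨ +-assoc (x ∸ y) y _ ⟨
    x ∸ y + y + (y ∸ x % y)   ≡⟨ cong (_+ (y ∸ x % y)) (m∸n+n≡m y≤x) ⟩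
    x + (y ∸ x % y)           ≡⟨ m+[n∸m%n]≡[1+m/n]*n x y ⟩
    suc (x / y) * y           ≡⟨ +-comm y (x / y * y) ⟩
    x / y * y + y             ∎)

mixed-product-≤ : ∀ b c {k t x} → k ≤ x → c * t ≤ b * k →
  (k + t) * (b * k + c * x) ≤ (b + c) * k * (x + t)
mixed-product-≤ b c {k} {t} k≤x ct≤bk with m≤n⇒∃[o]m+o≡n k≤x
... | d , refl = +-cancelʳ-≤ (d * (c * t)) _ _ (begin
    (k + t) * (b * k + c * (k + d)) + d * (c * t) ≤⟨ +-monoʳ-≤ _ (*-monoʳ-≤ d ct≤bk) ⟩
    (k + t) * (b * k + c * (k + d)) + d * (b * k) ≡⟨ expand b c k t d ⟩
    (b + c) * k * (k + d + t) + d * (c * t)       ∎)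
  where
  open ≤-Reasoning
  expand : ∀ b c k t d → (k + t) * (b * k + c * (k + d)) + d * (b * k)
                       ≡ (b + c) * k * (k + d + t) + d * (c * t)
  expand = solve-∀

density-bound : ∀ b c h e {m k t x} .{{_ : NonZero b}} .{{_ : NonZero h}} →
  h * e ≡ b + c → h * c ≤ b * (b + c) →
  b * m ≤ k → h * m ≤ k + t → k ≤ x → m * (b * k + c * x) ≤ e * k * (x + t)
density-bound b c h e {m} {k} {t} {x} he≡b+c hc≤b[b+c] bm≤k hm≤k+t k≤x with ≤-total (b * k) (c * t)
... | inj₁ bk≤ct = *-cancelˡ-≤ h (*-cancelˡ-≤ b (begin
    b * (h * (m * D))           ≡⟨ regroup₁ b h m D ⟩
    b * m * (h * D)             ≤⟨ *-monoˡ-≤ (h * D) bm≤k ⟩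
    k * (h * D)                 ≤⟨ *-monoʳ-≤ k (*-monoʳ-≤ h (+-monoˡ-≤ (c * x) bk≤ct)) ⟩
    k * (h * (c * t + c * x))   ≡⟨ regroup₂ k h c t x ⟩
    k * (h * c * (x + t))       ≤⟨ *-monoʳ-≤ k (*-monoˡ-≤ (x + t) hc≤b[b+c]) ⟩
    k * (b * (b + c) * (x + t)) ≡⟨ cong (λ z → k * (b * z * (x + t))) he≡b+c ⟨
    k * (b * (h * e) * (x + t)) ≡⟨ regroup₃ k b h e (x + t) ⟩
    b * (h * (e * k * (x + t))) ∎))
  where
  open ≤-Reasoning
  D : ℕ
  D = b * k + c * x
  regroup₁ : ∀ b h m D → b * (h * (m * D)) ≡ b * m * (h * D)
  regroup₁ = solve-∀
  regroup₂ : ∀ k h c t x → k * (h * (c * t + c * x)) ≡ k * (h * c * (x + t))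
  regroup₂ = solve-∀
  regroup₃ : ∀ k b h e s → k * (b * (h * e) * s) ≡ b * (h * (e * k * s))
  regroup₃ = solve-∀
... | inj₂ ct≤bk = *-cancelˡ-≤ h (begin
    h * (m * D)           ≡⟨ *-assoc h m D ⟨
    h * m * D             ≤⟨ *-monoˡ-≤ D hm≤k+t ⟩
    (k + t) * D           ≤⟨ mixed-product-≤ b c k≤x ct≤bk ⟩
    (b + c) * k * (x + t) ≡⟨ cong (λ z → z * k * (x + t)) he≡b+c ⟨
    h * e * k * (x + t)   ≡⟨ regroup h e k (x + t) ⟩
    h * (e * k * (x + t)) ∎)
  where
  open ≤-Reasoning
  D : ℕ
  D = b * k + c * x
  regroup : ∀ h e k s → h * e * k * s ≡ h * (e * k * s)
  regroup = solve-∀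

κ-shape : ∀ e h {m D k t x y} → x + t ≡ h * y → m * D ≤ e * k * (x + t) →
  m * D * x ≤ e * h * x * k * y
κ-shape e h {m} {D} {k} {t} {x} {y} x+t≡hy mD≤ = begin
  m * D * x           ≤⟨ *-monoˡ-≤ x mD≤ ⟩
  e * k * (x + t) * x ≡⟨ cong (λ z → e * k * z * x) x+t≡hy ⟩
  e * k * (h * y) * x ≡⟨ regroup e h k x y ⟩
  e * h * x * k * y   ∎
  where
  open ≤-Reasoning
  regroup : ∀ e h k x y → e * k * (h * y) * x ≡ e * h * x * k * y
  regroup = solve-∀

κ-bound : ∀ x y .{{_ : NonZero y}} → y ≤ x → ∀ {m k} →
  x / y * m ≤ k → suc (x / y) * m ≤ k + (y ∸ x % y) → k ≤ x →
  m * proj₂ (κ x y k) * x ≤ proj₁ (κ x y k) * k * y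
κ-bound x y y≤x {m} {k} qm≤k _ _ with y ∣? x
... | yes y∣x = begin
  m * 1 * x           ≡⟨ cong (m * 1 *_) (m/n*n≡m y∣x) ⟨
  m * 1 * (x / y * y) ≡⟨ regroup m (x / y) y ⟩
  x / y * m * y       ≤⟨ *-monoˡ-≤ y qm≤k ⟩
  k * y               ≡⟨ cong (_* y) (*-identityˡ k) ⟨
  1 * k * y           ∎
  where
  open ≤-Reasoning
  regroup : ∀ m q y → m * 1 * (q * y) ≡ q * m * y
  regroup = solve-∀
κ-bound x y y≤x {m} {k} qm≤k q+1m≤k+t k≤x | no _
  with x / y in x/y≡ | m+[n∸m%n]≡[1+m/n]*n x y
... | zero        | _     = ⊥-elim (n≮n 0 (subst (0 <_) x/y≡ (m≥n⇒m/n>0 y≤x)))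
... | suc zero    | x+t≡  =
  κ-shape 1 2 {m} {k + x} {k} {t} {x} {y} x+t≡
    (subst (λ D → m * D ≤ 1 * k * (x + t)) (cong₂ _+_ (*-identityˡ k) (*-identityˡ x))
           (density-bound 1 1 2 1 {m} {k} {t} {x} refl ≤-refl qm≤k q+1m≤k+t k≤x))
  where
  t : ℕ
  t = y ∸ x % y
... | suc (suc p) | x+t≡ =
  κ-shape 2 (3 + p) {m} {(2 + p) * k + (3 + p + 1) * x} {k} {t} {x} {y} x+t≡
    (density-bound (2 + p) (3 + p + 1) (3 + p) 2 {m} {k} {t} {x}
                   (h*2≡b+c p) (h*c≤b*[b+c] p) qm≤k q+1m≤k+t k≤x)
  where
  t : ℕ
  t = y ∸ x % y
  h*2≡b+c : ∀ p → (3 + p) * 2 ≡ 2 + p + (3 + p + 1)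
  h*2≡b+c = solve-∀
  h*c≤b*[b+c] : ∀ p → (3 + p) * (3 + p + 1) ≤ (2 + p) * (2 + p + (3 + p + 1))
  h*c≤b*[b+c] p = begin
    (3 + p) * (3 + p + 1)               ≤⟨ m≤m+n _ (p * (3 + p)) ⟩
    (3 + p) * (3 + p + 1) + p * (3 + p) ≡⟨ expand p ⟩
    (2 + p) * (2 + p + (3 + p + 1))     ∎
    where
    open ≤-Reasoning
    expand : ∀ p → (3 + p) * (3 + p + 1) + p * (3 + p) ≡ (2 + p) * (2 + p + (3 + p + 1))
    expand = solve-∀

lemma2p5 : (x y : ℕ) .{{_ : NonZero y}} → y ≤ x → (I : Subset x) →
    ∃[ a ] (a + y ≤ x ×
      ∣ I ∩ block x a y ∣ * proj₂ (κ x y ∣ I ∣) * x ≤ proj₁ (κ x y ∣ I ∣) * ∣ I ∣ * y)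
lemma2p5 x y y≤x I with sparse-block x y y≤x I
... | a , a+y≤x , aligned , last = a , a+y≤x , κ-bound x y y≤x aligned last (∣p∣≤n I)
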